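{- For every integer $k\ge 4$, the strong $k$-colour graph $S_k(P_{k+1})$ of the path $P_{k+1}$ on $k+1$ vertices is connected.
   Context: A proper $k$-colouring of a graph $G$ is a map $V(G)\to\{1,\dots,k\}$ giving adjacent vertices different colours; it is strong if all $k$ colours appear. The strong $k$-colour graph $S_k(G)$ has the strong $k$-colourings of $G$ as vertices, two being adjacent iff they differ in colour on exactly one vertex of $G$. -}

module Defs where

open import Data.Nat using (ℕ; suc)
open import Data.Fin using (Fin; inject₁; suc)
open import Data.Product using (Σ; ∃; _×_; _,_; proj₁)
open import Relation.Binary.PropositionalEquality using (_≡_; _≢_)
open import Relation.Binary.Construct.Closure.ReflexiveTransitive using (Star)

Colouring : ℕ → ℕ → Set
Colouring n k = Fin n → Fin k

ProperPath : ∀ {n k} → Colouring (suc n) k → Set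
ProperPath {n} c = (i : Fin n) → c (inject₁ i) ≢ c (suc i)

Surjective : ∀ {n k} → Colouring n k → Set
Surjective {n} {k} c = (a : Fin k) → ∃ λ (v : Fin n) → c v ≡ a

StrongPathColouring : ℕ → ℕ → Set
StrongPathColouring n k = Σ (Colouring (suc n) k) λ c → ProperPath c × Surjective c

DifferExactlyOne : ∀ {n k} → Colouring n k → Colouring n k → Set
DifferExactlyOne {n} c d = ∃ λ (v : Fin n) → (c v ≢ d v) × ((w : Fin n) → w ≢ v → c w ≡ d w)

SAdj : ∀ {n k} → StrongPathColouring n k → StrongPathColouring n k → Set
SAdj x y = DifferExactlyOne (proj₁ x) (proj₁ y)

SConnected : ℕ → ℕ → Set
SConnected n k = (x y : StrongPathColouring n k) → Star SAdj x y

module Submission where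

-- A strong k-colouring of the path on k + 1 vertices repeats exactly one colour, on exactly two
-- vertices; call either of them a hole.  Recolouring a hole p with the colour of a vertex r at
-- distance at least 2 from p keeps the colouring proper and strong and makes r a hole, so the hole
-- moves like the blank of a sliding puzzle whose moves are the jumps of length at least 2.  Such
-- moves place the colours k - 1, k - 2, ..., 3 on the vertices k, k - 1, ..., 4 one at a time, each
-- time working inside the five highest unsettled vertices.  What remains is a puzzle on the vertices
-- 0, ..., 4 with finitely many configurations, each solved by an explicit move sequence checked by
-- evaluation.  Hence every strong colouring is joined to the colouring 1, 0, 1, 2, ..., k - 1.

open import Defs
open import Data.Fin as Fin using (Fin; zero; suc; toℕ; inject₁; fromℕ<; punchIn; punchOut; #_)
open import Data.Fin.Properties
  using (toℕ-injective; toℕ-fromℕ<; toℕ-inject₁; toℕ<n; pigeonhole; injective⇒≤; punchIn-punchOut; all?)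
open import Data.List using (List; []; _∷_; map)
open import Data.List.Relation.Unary.All as All using (All; []; _∷_)
import Data.List.Relation.Unary.All.Properties as Allₚ
open import Data.List.Relation.Unary.AllPairs using ([]; _∷_)
open import Data.List.Relation.Unary.Any as Any using (Any; any?)
open import Data.List.Relation.Unary.Linked as Linked using (Linked; []; [-]; _∷_; linked?)
import Data.List.Relation.Unary.Linked.Properties as Linkedₚ
open import Data.List.Relation.Unary.Unique.Propositional using (Unique)
open import Data.List.Relation.Unary.Unique.DecPropositional (Fin._≟_ {5}) using (unique?)
open import Data.Nat using (ℕ; zero; suc; _+_; _∸_; _≤_; _<_; z≤n; s≤s; s≤s⁻¹; ∣_-_∣; _≤?_)
open import Data.Nat.Properties
open import Data.Product using (∃; _×_; _,_; proj₁; proj₂)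
open import Data.Sum using (_⊎_; inj₁; inj₂)
open import Data.Vec as Vec using (tabulate; _∷_; [])
open import Data.Vec.Properties using (≡-dec; lookup∘tabulate)
open import Data.Vec.Functional using (updateAt)
open import Data.Vec.Functional.Properties using (updateAt-updates; updateAt-minimal)
open import Function using (_∘_; id; const; case_of_)
open import Function.Definitions using (Injective)
open import Relation.Binary using (Decidable)
open import Relation.Binary.PropositionalEquality
open import Relation.Binary.Construct.Closure.ReflexiveTransitive using (Star; ε; _◅_; _◅◅_; reverse)
open import Relation.Nullary using (¬_; yes; no; contradiction)
open import Relation.Nullary.Decidable using (map′; from-yes; _×-dec_; _→-dec_)

private variable
  m n k : ℕ

record Far (u v : Fin m) : Set where
  constructor apart
  field distance : 2 ≤ ∣ toℕ u - toℕ v ∣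

Adjacent : Fin m → Fin m → Set
Adjacent u v = ∣ toℕ u - toℕ v ∣ ≡ 1

far? : Decidable (Far {m})
far? u v = map′ apart Far.distance (2 ≤? ∣ toℕ u - toℕ v ∣)

far-sym : ∀ {u v : Fin m} → Far u v → Far v u
far-sym {u = u} {v} (apart d) = apart (subst (2 ≤_) (∣-∣-comm (toℕ u) (toℕ v)) d)

far⇒≢ : ∀ {u v : Fin m} → Far u v → u ≢ v
far⇒≢ {u = u} (apart d) refl = contradiction (subst (2 ≤_) (∣n-n∣≡0 (toℕ u)) d) λ ()

far⇒¬adjacent : ∀ {u v : Fin m} → Far u v → ¬ Adjacent u v
far⇒¬adjacent (apart d) adj = contradiction (subst (2 ≤_) adj d) λ { (s≤s ()) }

far-by-gap : ∀ {u v : Fin m} → 2 + toℕ u ≤ toℕ v → Far u v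
far-by-gap {u = u} {v} gap = apart (begin
  2                    ≤⟨ m+n≤o⇒m≤o∸n 2 gap ⟩
  toℕ v ∸ toℕ u        ≡⟨ m≤n⇒∣m-n∣≡n∸m (m+n≤o⇒n≤o 2 gap) ⟨
  ∣ toℕ u - toℕ v ∣     ∎)
  where open ≤-Reasoning

adjacent⇒≢ : ∀ (u v : Fin m) → Adjacent u v → u ≢ v
adjacent⇒≢ u _ adj refl = contradiction (trans (sym (∣n-n∣≡0 (toℕ u))) adj) λ ()

adjacent-sym : ∀ (u v : Fin m) → Adjacent u v → Adjacent v u
adjacent-sym u v = trans (∣-∣-comm (toℕ v) (toℕ u))

edge-adjacent : (i : Fin n) → Adjacent (inject₁ i) (suc i)
edge-adjacent i = begin
  ∣ toℕ (inject₁ i) - suc (toℕ i) ∣  ≡⟨ cong (λ t → ∣ t - suc (toℕ i) ∣) (toℕ-inject₁ i) ⟩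
  ∣ toℕ i - suc (toℕ i) ∣            ≡⟨ m≤n⇒∣m-n∣≡n∸m (n≤1+n (toℕ i)) ⟩
  suc (toℕ i) ∸ toℕ i                ≡⟨ m+n∸n≡m 1 (toℕ i) ⟩
  1                                  ∎
  where open ≡-Reasoning

-- Moving the hole

-- Moving the hole from p to r turns a colouring c into c ∘ redirect p r, and the hole walk p, rs
-- turns it into c ∘ trace p rs.
redirect : Fin m → Fin m → Fin m → Fin m
redirect p r = updateAt id p (const r)

redirect-hole : (p r : Fin m) → redirect p r p ≡ r
redirect-hole p r = updateAt-updates p id

redirect-other : ∀ {p r v : Fin m} → v ≢ p → redirect p r v ≡ v
redirect-other {p = p} {v = v} v≢p = updateAt-minimal v p id v≢p

redirect-≢ : ∀ {p r : Fin m} v → r ≢ p → redirect p r v ≢ p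
redirect-≢ {p = p} {r} v r≢p with v Fin.≟ p
... | yes refl = subst (_≢ p) (sym (redirect-hole p r)) r≢p
... | no v≢p   = subst (_≢ p) (sym (redirect-other v≢p)) v≢p

redirect-injective : ∀ {p r u v : Fin m} → u ≢ r → v ≢ r → redirect p r u ≡ redirect p r v → u ≡ v
redirect-injective {p = p} {r} {u} {v} u≢r v≢r eq with u Fin.≟ p | v Fin.≟ p
... | yes refl | yes refl = refl
... | yes refl | no v≢p   = contradiction (trans (sym (redirect-other v≢p)) (trans (sym eq) (redirect-hole p r))) v≢r
... | no u≢p   | yes refl = contradiction (trans (sym (redirect-other u≢p)) (trans eq (redirect-hole p r))) u≢r
... | no u≢p   | no v≢p   = trans (sym (redirect-other u≢p)) (trans eq (redirect-other v≢p))

redirect-map : ∀ {f : Fin m → Fin n} → Injective _≡_ _≡_ f →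
               ∀ p r v → redirect (f p) (f r) (f v) ≡ f (redirect p r v)
redirect-map {f = f} f-inj p r v with v Fin.≟ p
... | yes refl = trans (redirect-hole (f p) (f r)) (cong f (sym (redirect-hole p r)))
... | no v≢p   = trans (redirect-other (v≢p ∘ f-inj)) (cong f (sym (redirect-other v≢p)))

trace : Fin m → List (Fin m) → Fin m → Fin m
trace p []       = id
trace p (r ∷ rs) = redirect p r ∘ trace r rs

endOf : Fin m → List (Fin m) → Fin m
endOf p []       = p
endOf p (r ∷ rs) = endOf r rs

trace-outside : ∀ {p v : Fin m} {rs} → All (_≢ v) (p ∷ rs) → trace p rs v ≡ v
trace-outside {rs = []}     _              = refl
trace-outside {rs = r ∷ rs} (p≢v ∷ others) =
  trans (cong (redirect _ r) (trace-outside others)) (redirect-other (p≢v ∘ sym))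

trace-map : ∀ {f : Fin m → Fin n} → Injective _≡_ _≡_ f →
            ∀ p rs v → trace (f p) (map f rs) (f v) ≡ f (trace p rs v)
trace-map f-inj p []       v = refl
trace-map f-inj p (r ∷ rs) v =
  trans (cong (redirect _ _) (trace-map f-inj r rs v)) (redirect-map f-inj p r (trace r rs v))

endOf-map : ∀ (f : Fin m → Fin n) p rs → endOf (f p) (map f rs) ≡ f (endOf p rs)
endOf-map f p []       = refl
endOf-map f p (r ∷ rs) = endOf-map f r rs

record Hole (c : Colouring m k) (p : Fin m) : Set where
  field
    twin          : Fin m
    twin≢hole     : twin ≢ p
    twin-colour   : c twin ≡ c p
    injective-off : ∀ {u v} → u ≢ p → v ≢ p → c u ≡ c v → u ≡ v

hole-resp : ∀ {c d : Colouring m k} {p} → c ≗ d → Hole c p → Hole d p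
hole-resp c≗d hole = record
  { twin          = twin
  ; twin≢hole     = twin≢hole
  ; twin-colour   = trans (sym (c≗d twin)) (trans twin-colour (c≗d _))
  ; injective-off = λ u≢p v≢p eq → injective-off u≢p v≢p (trans (c≗d _) (trans eq (sym (c≗d _))))
  }
  where open Hole hole

locate : ∀ {c : Colouring m k} {p} → Surjective c → Hole c p → ∀ a → ∃ λ v → v ≢ p × c v ≡ a
locate {p = p} surj hole a with surj a
... | v , cv≡a with v Fin.≟ p
...   | yes refl = twin , twin≢hole , trans twin-colour cv≡a where open Hole hole
...   | no v≢p   = v , v≢p , cv≡a

distinct-colours : ∀ {c : Colouring m k} {u v a b} → c u ≡ a → c v ≡ b → a ≢ b → u ≢ v
distinct-colours cu cv a≢b refl = a≢b (trans (sym cu) cv)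

surjective⇒≤ : (f : Fin m → Fin k) → Surjective f → k ≤ m
surjective⇒≤ f surj = injective⇒≤ {f = proj₁ ∘ surj}
  λ {a} {b} eq → trans (sym (proj₂ (surj a))) (trans (cong f eq) (proj₂ (surj b)))

surjective-punchIn : (f : Fin (suc m) → Fin k) → Surjective f →
                     ∀ {i j} → i ≢ j → f i ≡ f j → Surjective (f ∘ punchIn i)
surjective-punchIn f surj {i} {j} i≢j fi≡fj a with surj a
... | v , fv≡a with v Fin.≟ i
...   | yes refl = punchOut i≢j , trans (cong f (punchIn-punchOut i≢j)) (trans (sym fi≡fj) fv≡a)
...   | no v≢i   = punchOut (v≢i ∘ sym) , trans (cong f (punchIn-punchOut (v≢i ∘ sym))) fv≡a

-- A surjection from k + 1 vertices onto k colours repeats exactly one colour exactly once: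
-- removing two independent repetitions would leave a surjection from k - 1 vertices.
hole-exists : (c : Colouring (2 + k) (suc k)) → Surjective c → ∃ (Hole c)
hole-exists {k} c surj with pigeonhole (n<1+n (suc k)) c
... | i , j , i<j , ci≡cj = i , record
  { twin          = j
  ; twin≢hole     = i≢j ∘ sym
  ; twin-colour   = sym ci≡cj
  ; injective-off = injective-off
  }
  where
  i≢j : i ≢ j
  i≢j = <⇒≢ i<j ∘ cong toℕ

  injective-off : ∀ {u v} → u ≢ i → v ≢ i → c u ≡ c v → u ≡ v
  injective-off {u} {v} u≢i v≢i cu≡cv with u Fin.≟ v
  ... | yes u≡v = u≡v
  ... | no u≢v = contradiction (surjective⇒≤ _ surj′′) (n≮n k)
    where
    c′ = c ∘ punchIn i
    surj′ : Surjective c′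
    surj′ = surjective-punchIn c surj i≢j ci≡cj
    u′ v′ : Fin (suc k)
    u′ = punchOut (u≢i ∘ sym)
    v′ = punchOut (v≢i ∘ sym)
    surj′′ : Surjective (c′ ∘ punchIn u′)
    surj′′ = surjective-punchIn c′ surj′ {u′} {v′}
      (u≢v ∘ λ eq → trans (sym (punchIn-punchOut _)) (trans (cong (punchIn i) eq) (punchIn-punchOut _)))
      (trans (cong c (punchIn-punchOut _)) (trans cu≡cv (cong c (sym (punchIn-punchOut _)))))

module _ {c : Colouring (suc n) k} {p r : Fin (suc n)} where

  redirect-invisible : c r ≡ c p → c ∘ redirect p r ≗ c
  redirect-invisible cr≡cp v with v Fin.≟ p
  ... | yes refl = trans (cong c (redirect-hole p r)) cr≡cp
  ... | no v≢p   = cong c (redirect-other v≢p)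

  differ-redirect : c r ≢ c p → DifferExactlyOne c (c ∘ redirect p r)
  differ-redirect cr≢cp =
    p , (λ eq → cr≢cp (sym (trans eq (cong c (redirect-hole p r))))) ,
    (λ w w≢p → sym (cong c (redirect-other w≢p)))

  surjective-redirect : Hole c p → Surjective c → Surjective (c ∘ redirect p r)
  surjective-redirect hole surj a with locate surj hole a
  ... | v , v≢p , cv≡a = v , trans (cong c (redirect-other v≢p)) cv≡a

  module _ (hole : Hole c p) (far : Far p r) where
    open Hole hole

    private
      r≢p : r ≢ p
      r≢p = far⇒≢ (far-sym far)

      new-colour : ∀ v → (v ≡ p × c (redirect p r v) ≡ c r) ⊎ (v ≢ p × c (redirect p r v) ≡ c v)
      new-colour v with v Fin.≟ p
      ... | yes refl = inj₁ (refl , cong c (redirect-hole p r))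
      ... | no v≢p   = inj₂ (v≢p , cong c (redirect-other v≢p))

      -- The only new colour, c r, is absent from the neighbours of p because r is not one of them.
      fresh : ∀ w → Adjacent p w → c r ≢ c w
      fresh w adj cr≡cw = far⇒¬adjacent far
        (subst (Adjacent p) (sym (injective-off r≢p (adjacent⇒≢ p w adj ∘ sym) cr≡cw)) adj)

    hole-redirect : Hole (c ∘ redirect p r) r
    hole-redirect = record
      { twin          = p
      ; twin≢hole     = r≢p ∘ sym
      ; twin-colour   = trans (cong c (redirect-hole p r)) (sym (cong c (redirect-other r≢p)))
      ; injective-off = λ {u} {v} u≢r v≢r eq →
          redirect-injective {p = p} u≢r v≢r (injective-off (redirect-≢ u r≢p) (redirect-≢ v r≢p) eq)
      }

    proper-redirect : ProperPath c → ProperPath (c ∘ redirect p r)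
    proper-redirect proper i eq with new-colour (inject₁ i) | new-colour (suc i)
    ... | inj₁ (u≡p , _)  | inj₁ (w≡p , _)  = adjacent⇒≢ _ _ (edge-adjacent i) (trans u≡p (sym w≡p))
    ... | inj₁ (u≡p , cu) | inj₂ (_ , cw)   =
      fresh _ (subst (λ u → Adjacent u (suc i)) u≡p (edge-adjacent i)) (trans (sym cu) (trans eq cw))
    ... | inj₂ (_ , cu)   | inj₁ (w≡p , cw) =
      fresh _ (subst (λ w → Adjacent w (inject₁ i)) w≡p (adjacent-sym (inject₁ i) (suc i) (edge-adjacent i)))
        (trans (sym cw) (trans (sym eq) cu))
    ... | inj₂ (_ , cu)   | inj₂ (_ , cw)   = proper i (trans (sym cu) (trans eq cw))

differ-sym : ∀ {c d : Colouring m k} → DifferExactlyOne c d → DifferExactlyOne d c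
differ-sym (v , cv≢dv , same) = v , cv≢dv ∘ sym , λ w w≢v → sym (same w w≢v)

differ-respˡ : ∀ {c c′ d : Colouring m k} → c ≗ c′ → DifferExactlyOne c d → DifferExactlyOne c′ d
differ-respˡ c≗c′ (v , cv≢dv , same) =
  v , cv≢dv ∘ trans (c≗c′ v) , λ w w≢v → trans (sym (c≗c′ w)) (same w w≢v)

infix 4 _⇝_
record _⇝_ (x : StrongPathColouring n k) (P : StrongPathColouring n k → Set) : Set where
  constructor reach
  field
    {end}   : StrongPathColouring n k
    walk    : Star SAdj x end
    reached : P end

return : ∀ {x} {P : StrongPathColouring n k → Set} → P x → x ⇝ P
return = reach ε

_>>=_ : ∀ {x} {P Q : StrongPathColouring n k → Set} → x ⇝ P → (∀ {y} → P y → y ⇝ Q) → x ⇝ Q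
reach x→y Py >>= f with f Py
... | reach y→z Qz = reach (x→y ◅◅ y→z) Qz

jump : ∀ {x : StrongPathColouring n k} {p r} → Hole (proj₁ x) p → Far p r →
       x ⇝ λ y → Hole (proj₁ y) r × proj₁ y ≗ proj₁ x ∘ redirect p r
jump {x = c , proper , surj} {p} {r} hole far with c r Fin.≟ c p
... | yes cr≡cp = return (hole-resp invisible (hole-redirect hole far) , sym ∘ invisible)
  where invisible = redirect-invisible {c = c} cr≡cp
... | no cr≢cp  =
  reach {end = c ∘ redirect p r , proper-redirect hole far proper , surjective-redirect hole surj}
        (differ-redirect cr≢cp ◅ ε) (hole-redirect hole far , λ _ → refl)

run : ∀ {x : StrongPathColouring n k} {p rs} → Hole (proj₁ x) p → Linked Far (p ∷ rs) →
      x ⇝ λ y → Hole (proj₁ y) (endOf p rs) × proj₁ y ≗ proj₁ x ∘ trace p rs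
run {rs = []}     hole _ = return (hole , λ _ → refl)
run {rs = r ∷ rs} hole (far ∷ linked) = do
  hole′ , moved ← jump hole far
  hole′′ , ran ← run hole′ linked
  return (hole′′ , λ v → trans (ran v) (moved (trace r rs v)))

-- The puzzle on five vertices

carry : List (Fin 5)
carry = # 1 ∷ # 3 ∷ # 0 ∷ # 4 ∷ # 1 ∷ []

carry-linked : Linked Far (# 4 ∷ carry)
carry-linked = from-yes (linked? far? (# 4 ∷ carry))

carry-lifts : trace (# 4) carry (# 4) ≡ # 3
carry-lifts = refl

carry-ends : endOf (# 4) carry ≡ # 1
carry-ends = refl

-- rs solves the configuration in which p is the hole and the colours 0, 1, 2, 3 sit at i₀, i₁, i₂, 4:
-- after the moves rs, vertex j carries the colour initially at the j-th entry, i.e. the colours read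
-- 1, 0, 1, 2, 3.
Solves : (p i₀ i₁ i₂ : Fin 5) → List (Fin 5) → Set
Solves p i₀ i₁ i₂ rs = Linked Far (p ∷ rs) × tabulate (trace p rs) ≡ i₁ ∷ i₀ ∷ i₁ ∷ i₂ ∷ # 4 ∷ []

-- Shortest solutions of the 24 configurations, found by breadth-first search.
endgame-moves : List (List (Fin 5))
endgame-moves =
    (# 2 ∷ [])
  ∷ (# 3 ∷ # 1 ∷ # 4 ∷ # 0 ∷ # 2 ∷ # 4 ∷ # 1 ∷ # 3 ∷ # 0 ∷ # 2 ∷ [])
  ∷ (# 4 ∷ # 1 ∷ # 3 ∷ # 0 ∷ # 2 ∷ # 4 ∷ # 0 ∷ # 3 ∷ # 1 ∷ # 4 ∷ # 0 ∷ # 2 ∷ [])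
  ∷ (# 2 ∷ # 4 ∷ # 0 ∷ # 3 ∷ # 1 ∷ # 4 ∷ # 2 ∷ # 0 ∷ [])
  ∷ (# 2 ∷ # 4 ∷ # 1 ∷ # 3 ∷ # 0 ∷ # 4 ∷ # 2 ∷ # 0 ∷ [])
  ∷ (# 3 ∷ # 1 ∷ # 4 ∷ # 0 ∷ # 2 ∷ # 4 ∷ # 1 ∷ # 3 ∷ # 0 ∷ # 2 ∷ # 4 ∷ # 0 ∷ # 3 ∷ # 1 ∷ # 4 ∷ # 2 ∷ # 0 ∷ [])
  ∷ (# 4 ∷ # 0 ∷ # 2 ∷ # 4 ∷ # 1 ∷ # 3 ∷ # 0 ∷ # 2 ∷ # 4 ∷ # 0 ∷ # 3 ∷ # 1 ∷ # 4 ∷ # 2 ∷ # 0 ∷ [])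
  ∷ (# 3 ∷ # 0 ∷ # 2 ∷ # 4 ∷ # 1 ∷ # 3 ∷ # 0 ∷ # 4 ∷ # 2 ∷ # 0 ∷ [])
  ∷ (# 3 ∷ # 0 ∷ # 2 ∷ # 4 ∷ # 0 ∷ # 3 ∷ # 1 ∷ # 4 ∷ # 2 ∷ # 0 ∷ [])
  ∷ (# 4 ∷ # 0 ∷ # 3 ∷ # 1 ∷ # 4 ∷ # 2 ∷ # 0 ∷ # 3 ∷ # 1 ∷ # 4 ∷ # 0 ∷ # 2 ∷ [])
  ∷ (# 4 ∷ # 0 ∷ # 2 ∷ # 4 ∷ # 1 ∷ # 3 ∷ # 0 ∷ # 2 ∷ [])
  ∷ (# 3 ∷ # 0 ∷ # 2 ∷ [])
  ∷ (# 0 ∷ # 4 ∷ # 1 ∷ # 3 ∷ # 0 ∷ # 2 ∷ # 4 ∷ # 0 ∷ # 3 ∷ # 1 ∷ # 4 ∷ # 0 ∷ # 2 ∷ [])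
  ∷ (# 4 ∷ # 0 ∷ # 3 ∷ # 1 ∷ # 4 ∷ # 2 ∷ # 0 ∷ [])
  ∷ (# 0 ∷ [])
  ∷ (# 0 ∷ # 3 ∷ # 1 ∷ # 4 ∷ # 0 ∷ # 2 ∷ # 4 ∷ # 1 ∷ # 3 ∷ # 0 ∷ # 2 ∷ [])
  ∷ (# 4 ∷ # 1 ∷ # 3 ∷ # 0 ∷ # 2 ∷ # 4 ∷ # 0 ∷ # 3 ∷ # 1 ∷ # 4 ∷ # 0 ∷ # 2 ∷ # 4 ∷ # 1 ∷ # 3 ∷ # 0 ∷ # 2 ∷ [])
  ∷ (# 4 ∷ # 1 ∷ # 3 ∷ # 0 ∷ # 4 ∷ # 2 ∷ # 0 ∷ [])
  ∷ (# 0 ∷ # 2 ∷ # 4 ∷ # 1 ∷ # 3 ∷ # 0 ∷ # 4 ∷ # 2 ∷ # 0 ∷ [])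
  ∷ (# 1 ∷ # 4 ∷ # 0 ∷ # 2 ∷ # 4 ∷ # 1 ∷ # 3 ∷ # 0 ∷ # 2 ∷ # 4 ∷ # 0 ∷ # 3 ∷ # 1 ∷ # 4 ∷ # 2 ∷ # 0 ∷ [])
  ∷ (# 1 ∷ # 4 ∷ # 0 ∷ # 2 ∷ # 4 ∷ # 1 ∷ # 3 ∷ # 0 ∷ # 2 ∷ [])
  ∷ (# 0 ∷ # 2 ∷ [])
  ∷ (# 0 ∷ # 2 ∷ # 4 ∷ # 0 ∷ # 3 ∷ # 1 ∷ # 4 ∷ # 2 ∷ # 0 ∷ [])
  ∷ (# 0 ∷ # 4 ∷ # 1 ∷ # 3 ∷ # 0 ∷ # 2 ∷ # 4 ∷ # 0 ∷ # 3 ∷ # 1 ∷ # 4 ∷ # 0 ∷ # 2 ∷ [])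
  ∷ []


-- Kept abstract so that uses of this fact never make the type checker unfold the decision procedure.
abstract
  endgame-solvable : ∀ p i₀ i₁ i₂ → Unique (p ∷ i₀ ∷ i₁ ∷ i₂ ∷ # 4 ∷ []) → Any (Solves p i₀ i₁ i₂) endgame-moves
  endgame-solvable = from-yes
    (all? λ p → all? λ i₀ → all? λ i₁ → all? λ i₂ →
      unique? (p ∷ i₀ ∷ i₁ ∷ i₂ ∷ # 4 ∷ []) →-dec
      any? (λ rs → linked? far? (p ∷ rs) ×-dec
                   ≡-dec Fin._≟_ (tabulate (trace p rs)) (i₁ ∷ i₀ ∷ i₁ ∷ i₂ ∷ # 4 ∷ []))
           endgame-moves)

-- Sorting the strong colourings

module _ (m : ℕ) where

  Position = Fin (5 + m)

  target : Colouring (5 + m) (4 + m)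
  target zero    = # 1
  target (suc v) = v

  toℕ-target : ∀ v {j} → toℕ v ≡ suc j → toℕ (target v) ≡ j
  toℕ-target (suc v) eq = suc-injective eq

  Placed : ℕ → Colouring (5 + m) (4 + m) → Set
  Placed a c = ∀ v → a < toℕ v → c v ≡ target v

  Settled : ℕ → StrongPathColouring (4 + m) (4 + m) → Set
  Settled a x = ∃ λ p → Hole (proj₁ x) p × toℕ p ≤ a × Placed a (proj₁ x)

  placed-resp : ∀ {a c d} → c ≗ d → Placed a c → Placed a d
  placed-resp c≗d placed v a<v = trans (sym (c≗d v)) (placed v a<v)

  placed-below : ∀ {a c v w} → Placed a c → c v ≡ w → toℕ w < a → toℕ v ≤ a
  placed-below {v = zero} _ _ _ = z≤n
  placed-below {a} {v = suc v} placed cv≡w w<a with toℕ (suc v) ≤? a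
  ... | yes v≤a = v≤a
  ... | no v≰a  =
    contradiction (subst (λ u → toℕ u < a) (trans (sym cv≡w) (placed (suc v) (≰⇒> v≰a))) w<a)
                  (≤⇒≯ (s≤s⁻¹ (≰⇒> v≰a)))

  placed-trace : ∀ {a c p rs} → Placed a c → All (λ r → toℕ r ≤ a) (p ∷ rs) → Placed a (c ∘ trace p rs)
  placed-trace {c = c} placed bounded v a<v =
    trans (cong c (trace-outside (All.map (λ r≤a r≡v → <⇒≱ (subst (λ w → _ < toℕ w) (sym r≡v) a<v) r≤a)
                                          bounded)))
          (placed v a<v)

  placed-lower : ∀ {a c} → Placed (suc a) c → ∀ w → toℕ w ≡ suc a → c w ≡ target w → Placed a c
  placed-lower {a} {c} placed w w≡1+a cw v a<v with toℕ v ≟ suc a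
  ... | yes v≡1+a = subst (λ u → c u ≡ target u) (toℕ-injective (trans w≡1+a (sym v≡1+a))) cw
  ... | no v≢1+a  = placed v (≤∧≢⇒< a<v (v≢1+a ∘ sym))

  module Window (b : ℕ) (fits : 4 + b ≤ 4 + m) where

    at : Fin 5 → Position
    at j = fromℕ< (s≤s (≤-trans (+-monoˡ-≤ b (s≤s⁻¹ (toℕ<n j))) fits))

    toℕ-at : ∀ j → toℕ (at j) ≡ toℕ j + b
    toℕ-at j = toℕ-fromℕ< _

    at-≤ : ∀ j → toℕ (at j) ≤ 4 + b
    at-≤ j = subst (_≤ 4 + b) (sym (toℕ-at j)) (+-monoˡ-≤ b (s≤s⁻¹ (toℕ<n j)))

    at-injective : Injective _≡_ _≡_ at
    at-injective {i} {j} eq =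
      toℕ-injective (+-cancelʳ-≡ b (toℕ i) (toℕ j) (trans (sym (toℕ-at i)) (trans (cong toℕ eq) (toℕ-at j))))

    at-covers : ∀ v → b ≤ toℕ v → toℕ v ≤ 4 + b → ∃ λ j → at j ≡ v
    at-covers v b≤v v≤4+b =
      j , toℕ-injective (trans (toℕ-at j) (trans (cong (_+ b) (toℕ-fromℕ< _)) (m∸n+n≡m b≤v)))
      where j = fromℕ< (s≤s (subst (toℕ v ∸ b ≤_) (m+n∸n≡m 4 b) (∸-monoˡ-≤ b v≤4+b)))

    far-at : ∀ {i j} → Far i j → Far (at i) (at j)
    far-at {i} {j} (apart d) = apart (subst (2 ≤_) (sym (begin
      ∣ toℕ (at i) - toℕ (at j) ∣   ≡⟨ cong₂ ∣_-_∣ (trans (toℕ-at i) (+-comm _ b))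
                                                    (trans (toℕ-at j) (+-comm _ b)) ⟩
      ∣ b + toℕ i - b + toℕ j ∣     ≡⟨ ∣m+n-m+o∣≡∣n-o∣ b (toℕ i) (toℕ j) ⟩
      ∣ toℕ i - toℕ j ∣             ∎)) d)
      where open ≡-Reasoning

    linked-at : ∀ {p rs} → Linked Far (p ∷ rs) → Linked Far (at p ∷ map at rs)
    linked-at linked = Linkedₚ.map⁺ {xs = _ ∷ _} (Linked.map far-at linked)

    top : Position
    top = at (# 4)

    top-at : ∀ {v} → toℕ v ≡ 4 + b → top ≡ v
    top-at v≡4+b = toℕ-injective (trans (toℕ-at (# 4)) (sym v≡4+b))

    far-top : ∀ {v} → toℕ v ≤ 2 + b → Far v top
    far-top {v} v≤2+b = far-by-gap (subst (2 + toℕ v ≤_) (sym (toℕ-at (# 4))) (s≤s (s≤s v≤2+b)))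

    record Lifting (p i : Position) : Set where
      field
        moves      : List Position
        linked     : Linked Far (p ∷ moves)
        bounded    : All (λ r → toℕ r ≤ 4 + b) moves
        ends-below : toℕ (endOf p moves) ≤ 3 + b
        lifts      : trace p moves top ≡ i

    prepend : ∀ {p r i} → Far p r → toℕ r ≤ 4 + b → i ≢ p → Lifting r i → Lifting p i
    prepend {p} {r} far r≤ i≢p L = record
      { moves      = r ∷ moves
      ; linked     = far ∷ linked
      ; bounded    = r≤ ∷ bounded
      ; ends-below = ends-below
      ; lifts      = trans (cong (redirect p r) lifts) (redirect-other i≢p)
      }
      where open Lifting L

    lift-from-top : ∀ {i} → toℕ i ≤ 3 + b → Lifting top i
    lift-from-top {i} i≤3+b with m≤n⇒m<n∨m≡n i≤3+b
    ... | inj₁ i<3+b = record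
      { moves      = i ∷ []
      ; linked     = far-sym (far-top (s≤s⁻¹ i<3+b)) ∷ [-]
      ; bounded    = m≤n⇒m≤1+n i≤3+b ∷ []
      ; ends-below = i≤3+b
      ; lifts      = redirect-hole top i
      }
    ... | inj₂ i≡3+b = record
      { moves      = map at carry
      ; linked     = linked-at carry-linked
      ; bounded    = Allₚ.map⁺ (All.universal at-≤ carry)
      ; ends-below = subst (λ e → toℕ e ≤ 3 + b) (sym (trans (endOf-map at (# 4) carry) (cong at carry-ends)))
                           (≤-trans (≤-reflexive (toℕ-at (# 1))) (+-monoˡ-≤ b (s≤s z≤n)))
      ; lifts      = begin
          trace top (map at carry) top  ≡⟨ trace-map at-injective (# 4) carry (# 4) ⟩
          at (trace (# 4) carry (# 4))  ≡⟨ cong at carry-lifts ⟩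
          at (# 3)                      ≡⟨ toℕ-injective (trans (toℕ-at (# 3)) (sym i≡3+b)) ⟩
          i                             ∎
      }
      where open ≡-Reasoning

    low-position-avoiding : ∀ i → ∃ λ s → toℕ s ≤ 1 + b × i ≢ s
    low-position-avoiding i with i Fin.≟ at (# 0)
    ... | yes i≡at0 = at (# 1) , ≤-reflexive (toℕ-at (# 1)) ,
                      λ i≡at1 → case at-injective (trans (sym i≡at0) i≡at1) of λ ()
    ... | no i≢at0  = at (# 0) , ≤-trans (≤-reflexive (toℕ-at (# 0))) (n≤1+n b) , i≢at0

    -- The top is adjacent to 3 + b, so the hole detours through b or b + 1, whichever avoids i.
    lift-from-second : ∀ {p i} → toℕ p ≡ 3 + b → toℕ i ≤ 3 + b → i ≢ p → Lifting p i
    lift-from-second {p} {i} p≡3+b i≤3+b i≢p with low-position-avoiding i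
    ... | s , s≤1+b , i≢s =
      prepend (far-sym (far-by-gap (subst (2 + toℕ s ≤_) (sym p≡3+b) (s≤s (s≤s s≤1+b)))))
              (≤-trans s≤1+b (+-monoˡ-≤ b (s≤s z≤n))) i≢p
              (prepend (far-top (m≤n⇒m≤1+n s≤1+b)) (at-≤ (# 4)) i≢s (lift-from-top i≤3+b))

    lifting : ∀ {p i} → toℕ p ≤ 4 + b → toℕ i ≤ 4 + b → i ≢ p → Lifting p i
    lifting {p} {i} p≤4+b i≤4+b i≢p with m≤n⇒m<n∨m≡n i≤4+b
    ... | inj₂ i≡4+b = record
      { moves = [] ; linked = [-] ; bounded = [] ; ends-below = p≤3+b ; lifts = top-at i≡4+b }
      where p≤3+b = s≤s⁻¹ (≤∧≢⇒< p≤4+b λ p≡4+b → i≢p (toℕ-injective (trans i≡4+b (sym p≡4+b))))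
    ... | inj₁ i<4+b with m≤n⇒m<n∨m≡n p≤4+b
    ...   | inj₂ p≡4+b = subst (λ q → Lifting q i) (top-at p≡4+b) (lift-from-top (s≤s⁻¹ i<4+b))
    ...   | inj₁ p<4+b with m≤n⇒m<n∨m≡n (s≤s⁻¹ p<4+b)
    ...     | inj₁ p<3+b = prepend (far-top (s≤s⁻¹ p<3+b)) (at-≤ (# 4)) i≢p (lift-from-top (s≤s⁻¹ i<4+b))
    ...     | inj₂ p≡3+b = lift-from-second p≡3+b (s≤s⁻¹ i<4+b) i≢p

  settle-step : ∀ b → 4 + b ≤ 4 + m → ∀ {x} → Settled (4 + b) x → x ⇝ Settled (3 + b)
  settle-step b fits {x@(c , _ , surj)} (p , hole , p≤4+b , placed)
    with locate surj hole (target (Window.top b fits))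
  ... | i , i≢p , ci≡target = do
      hole′ , ran ← run hole linked
      return (endOf p moves , hole′ , ends-below , placed-resp (sym ∘ ran) placed′)
    where
    open Window b fits
    i≤4+b : toℕ i ≤ 4 + b
    i≤4+b = placed-below placed ci≡target (≤-reflexive (cong suc (toℕ-target top (toℕ-at (# 4)))))
    open Lifting (lifting p≤4+b i≤4+b i≢p)
    placed′ : Placed (3 + b) (c ∘ trace p moves)
    placed′ = placed-lower (placed-trace placed (p≤4+b ∷ bounded)) top (toℕ-at (# 4))
                           (trans (cong c lifts) ci≡target)

  settle : ∀ d → 3 + d ≤ 4 + m → ∀ {x} → Settled (3 + d) x → x ⇝ Settled 3
  settle zero    _    settled = return settled
  settle (suc d) fits settled = settle-step d fits settled >>= settle d (≤-trans (n≤1+n _) fits)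

  module Bottom = Window 0 (+-monoʳ-≤ 4 z≤n)

  solve-bottom : ∀ {x} p i₀ i₁ i₂ → let open Bottom; c = proj₁ x in
                 Hole c (at p) → Placed 3 c → c (at i₀) ≡ # 0 → c (at i₁) ≡ # 1 → c (at i₂) ≡ # 2 →
                 Unique (p ∷ i₀ ∷ i₁ ∷ i₂ ∷ # 4 ∷ []) → x ⇝ λ y → proj₁ y ≗ target
  solve-bottom {x} p i₀ i₁ i₂ hole placed c₀ c₁ c₂ unique
    with Any.satisfied (endgame-solvable p i₀ i₁ i₂ unique)
  ... | rs , linked , traced = do
      _ , ran ← run hole (linked-at linked)
      return λ v → trans (ran v) (solved v)
    where
    open Bottom
    c = proj₁ x
    sources : ∀ j → trace p rs j ≡ Vec.lookup (i₁ ∷ i₀ ∷ i₁ ∷ i₂ ∷ # 4 ∷ []) j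
    sources j = trans (sym (lookup∘tabulate (trace p rs) j)) (cong (λ t → Vec.lookup t j) traced)
    coloured : ∀ j → c (at (Vec.lookup (i₁ ∷ i₀ ∷ i₁ ∷ i₂ ∷ # 4 ∷ []) j)) ≡ target (at j)
    coloured zero                         = c₁
    coloured (suc zero)                   = c₀
    coloured (suc (suc zero))             = c₁
    coloured (suc (suc (suc zero)))       = c₂
    coloured (suc (suc (suc (suc zero)))) = placed (at (# 4)) (s≤s (s≤s (s≤s (s≤s z≤n))))
    solved : c ∘ trace (at p) (map at rs) ≗ target
    solved v with toℕ v ≤? 4
    ... | yes v≤4 with at-covers v z≤n v≤4
    ...   | j , refl = trans (cong c (trans (trace-map at-injective p rs j) (cong at (sources j)))) (coloured j)
    solved v | no v≰4 =
      placed-trace (λ w 4<w → placed w (<-trans (n<1+n 3) 4<w)) (at-≤ p ∷ Allₚ.map⁺ (All.universal at-≤ rs))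
                   v (≰⇒> v≰4)

  in-bottom : ∀ {v} → toℕ v ≤ 3 → ∃ λ j → Bottom.at j ≡ v × j ≢ # 4
  in-bottom {v} v≤3 with Bottom.at-covers v z≤n (m≤n⇒m≤1+n v≤3)
  ... | j , refl = j , refl , λ { refl → contradiction v≤3 λ { (s≤s (s≤s (s≤s ()))) } }

  endgame : ∀ {x} → Settled 3 x → x ⇝ λ y → proj₁ y ≗ target
  endgame {x@(c , _ , surj)} (p , hole , p≤3 , placed)
    with locate surj hole (# 0) | locate surj hole (# 1) | locate surj hole (# 2)
  ... | i₀ , i₀≢p , c₀ | i₁ , i₁≢p , c₁ | i₂ , i₂≢p , c₂
    with in-bottom p≤3
       | in-bottom (placed-below placed c₀ (s≤s z≤n))
       | in-bottom (placed-below placed c₁ (s≤s (s≤s z≤n)))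
       | in-bottom (placed-below placed c₂ (s≤s (s≤s (s≤s z≤n))))
  ... | p′ , refl , p′≢4 | i₀′ , refl , i₀′≢4 | i₁′ , refl , i₁′≢4 | i₂′ , refl , i₂′≢4 =
    solve-bottom p′ i₀′ i₁′ i₂′ hole placed c₀ c₁ c₂
      ( (p′≢ i₀≢p ∷ p′≢ i₁≢p ∷ p′≢ i₂≢p ∷ p′≢4 ∷ [])
      ∷ (separated c₀ c₁ (λ ()) ∷ separated c₀ c₂ (λ ()) ∷ i₀′≢4 ∷ [])
      ∷ (separated c₁ c₂ (λ ()) ∷ i₁′≢4 ∷ [])
      ∷ (i₂′≢4 ∷ [])
      ∷ [] ∷ [])
    where
    open Bottom
    p′≢ : ∀ {i} → at i ≢ at p′ → p′ ≢ i
    p′≢ i≢p eq = i≢p (cong at (sym eq))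
    separated : ∀ {i j a b} → c (at i) ≡ a → c (at j) ≡ b → a ≢ b → i ≢ j
    separated ci cj a≢b = distinct-colours {c = c} ci cj a≢b ∘ cong at

  settled-initially : (x : StrongPathColouring (4 + m) (4 + m)) → Settled (4 + m) x
  settled-initially (c , _ , surj) with hole-exists c surj
  ... | p , hole = p , hole , s≤s⁻¹ (toℕ<n p) , λ v 4+m<v → contradiction (s≤s⁻¹ (toℕ<n v)) (<⇒≱ 4+m<v)

  reaches-target : (x : StrongPathColouring (4 + m) (4 + m)) → x ⇝ λ y → proj₁ y ≗ target
  reaches-target x = settle (suc m) ≤-refl (settled-initially x) >>= endgame

  target-proper : ProperPath target
  target-proper zero    = λ ()
  target-proper (suc i) = adjacent⇒≢ _ _ (edge-adjacent i)

  target-strong : StrongPathColouring (4 + m) (4 + m)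
  target-strong = target , target-proper , λ a → suc a , refl

  recoloured-target : StrongPathColouring (4 + m) (4 + m)
  recoloured-target = recoloured , proper , λ a → suc a , refl
    where
    recoloured : Colouring (5 + m) (4 + m)
    recoloured zero    = # 2
    recoloured (suc v) = v
    proper : ProperPath recoloured
    proper zero    = λ ()
    proper (suc i) = target-proper (suc i)

  target-adjacent : SAdj target-strong recoloured-target
  target-adjacent = zero , (λ ()) , λ { zero 0≢0 → contradiction refl 0≢0 ; (suc _) _ → refl }

  -- Pointwise equality with target does not make a strong colouring equal to target-strong, whose
  -- proof components may differ; hence the detour through a neighbour.
  detour : ∀ {y} → proj₁ y ≗ target → Star SAdj y target-strong
  detour {y} y≗target = _◅_ {j = recoloured-target} there (back ◅ ε)
    where
    there : SAdj y recoloured-target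
    there = differ-respˡ (sym ∘ y≗target) target-adjacent
    back : SAdj recoloured-target target-strong
    back = differ-sym target-adjacent

  walk-to-target : ∀ {x} → x ⇝ (λ y → proj₁ y ≗ target) → Star SAdj x target-strong
  walk-to-target (reach x→y y≗target) = x→y ◅◅ detour y≗target

  connected : SConnected (4 + m) (4 + m)
  connected x y = walk-to-target (reaches-target x) ◅◅ reverse differ-sym (walk-to-target (reaches-target y))

proposition3p2 : (k : ℕ) → 4 ≤ k → SConnected k k
proposition3p2 k 4≤k = subst (λ k → SConnected k k) (m+[n∸m]≡n 4≤k) (connected (k ∸ 4))
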